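{- Let $G$ be a graph of order $n$ and diameter $D$. Let $uv$ be an edge of $G$ such that the graph $H=G-uv$ (obtained from $G$ by deleting the edge $uv$) is connected. Then, for every vertex $w\in V(G)$, \[ \mathrm{dist}_H(w,u)+\mathrm{dist}_H(w,v)\leq 2D. \]
   Context: All graphs are finite and simple. $\mathrm{dist}_F(x,y)$ denotes the length of a shortest path joining vertices $x$ and $y$ in a graph $F$. A graph of diameter $D$ is connected and $D$ is the maximum of $\mathrm{dist}_G(x,y)$ over all pairs of vertices. -}

module Defs where

open import Data.Nat using (ℕ; zero; suc; _≤_; _<_)
open import Data.Fin using (Fin)
open import Data.Fin.Properties using (_≟_)
open import Data.Bool using (Bool; true; false; _∧_; _∨_; not)
open import Data.Product using (Σ; _×_; ∃; ∃-syntax; _,_)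
open import Relation.Binary.PropositionalEquality using (_≡_)
open import Relation.Nullary using (¬_)
open import Relation.Nullary.Decidable using (⌊_⌋)

record Graph (n : ℕ) : Set where
  field
    adj   : Fin n → Fin n → Bool
    sym   : ∀ x y → adj x y ≡ adj y x
    irrefl : ∀ x → adj x x ≡ false
open Graph public

Adj : ∀ {n} → Graph n → Fin n → Fin n → Set
Adj G x y = adj G x y ≡ true

data Walk {n : ℕ} (G : Graph n) : Fin n → Fin n → ℕ → Set where
  here : ∀ {x} → Walk G x x zero
  step : ∀ {x y z k} → Adj G x y → Walk G y z k → Walk G x z (suc k)

IsDist : ∀ {n} → Graph n → Fin n → Fin n → ℕ → Set
IsDist G x y d = Walk G x y d × (∀ k → k < d → ¬ Walk G x y k)

Connected : ∀ {n} → Graph n → Set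
Connected G = ∀ x y → ∃[ k ] Walk G x y k

HasDiameter : ∀ {n} → Graph n → ℕ → Set
HasDiameter G D =
  Connected G ×
  (∀ x y d → IsDist G x y d → d ≤ D) ×
  (∃[ x ] ∃[ y ] IsDist G x y D)

samePair : ∀ {n} → Fin n → Fin n → Fin n → Fin n → Bool
samePair u v x y = (⌊ x ≟ u ⌋ ∧ ⌊ y ≟ v ⌋) ∨ (⌊ x ≟ v ⌋ ∧ ⌊ y ≟ u ⌋)

deleteEdge : ∀ {n} → Graph n → Fin n → Fin n → Graph n
deleteEdge {n} G u v = record
  { adj = λ x y → adj G x y ∧ not (samePair u v x y)
  ; sym = λ x y → symLemma x y
  ; irrefl = λ x → irrLemma x }
  where
  open import Relation.Binary.PropositionalEquality using (cong₂; refl; trans)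
  open import Data.Bool.Properties using (∨-comm; ∧-comm)
  sp : ∀ x y → samePair u v x y ≡ samePair u v y x
  sp x y = trans (∨-comm (⌊ x ≟ u ⌋ ∧ ⌊ y ≟ v ⌋) (⌊ x ≟ v ⌋ ∧ ⌊ y ≟ u ⌋))
    (cong₂ _∨_ (∧-comm ⌊ x ≟ v ⌋ ⌊ y ≟ u ⌋) (∧-comm ⌊ x ≟ u ⌋ ⌊ y ≟ v ⌋))
  symLemma : ∀ x y → (adj G x y ∧ not (samePair u v x y)) ≡ (adj G y x ∧ not (samePair u v y x))
  symLemma x y = cong₂ (λ a b → a ∧ not b) (Graph.sym G x y) (sp x y)
  irrLemma : ∀ x → (adj G x x ∧ not (samePair u v x x)) ≡ false
  irrLemma x rewrite Graph.irrefl G x = refl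

module Submission where

-- Write a = dist_G(w,u), b = dist_G(w,v), H = G - uv, and by
-- symmetry assume a ≤ b.  The key observation is that a G-walk from w to z
-- that is no longer than both dist_G(w,u) + dist_G(v,z) and
-- dist_G(w,v) + dist_G(u,z) cannot traverse the edge uv, so it is an H-walk.
--   * Near endpoint: a shortest G-path from w to u avoids uv, so
--     dist_H(w,u) ≤ a.
--   * Far endpoint: if b ≤ a (i.e. a = b) the same argument gives
--     dist_H(w,v) ≤ b ≤ D.  Otherwise follow an H-walk from w to v and take
--     the first edge z'z entering the set of vertices z "behind the edge",
--     those with a + dist_G(v,z) < dist_G(w,z).  Shortest G-paths w → z' and
--     v → z avoid uv, so dist_H(w,v) ≤ dist_G(w,z') + 1 + dist_G(v,z), while
--     a + 1 + dist_G(v,z) ≤ dist_G(w,z) ≤ D.  In both cases a + dist_H(w,v) ≤ 2D.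
-- Adding the two bounds proves the theorem.

open import Defs hiding (sym)
open import Data.Nat using (ℕ; zero; suc; _+_; _*_; _≤_; _<_; _≤?_)
open import Data.Nat.Properties
open import Data.Nat.Induction using (<-rec)
open import Data.Nat.Tactic.RingSolver using (solve-∀)
open import Data.Fin using (Fin)
open import Data.Fin.Properties using (any?) renaming (_≟_ to _≟ᶠ_)
open import Data.Bool using (true)
open import Data.Bool.Properties using () renaming (_≟_ to _≟ᵇ_)
open import Data.Product using (_×_; ∃-syntax; _,_; proj₁; proj₂)
open import Data.Sum using (_⊎_; inj₁; inj₂)
open import Data.Empty using (⊥-elim)
open import Relation.Unary using (Pred; Decidable)
open import Relation.Nullary using (¬_; Dec; yes; no)
open import Relation.Nullary.Decidable using (_×-dec_)
open import Relation.Binary.PropositionalEquality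

least-witness : ∀ {p} {P : Pred ℕ p} → Decidable P → ∀ k → P k →
  ∃[ m ] (P m × (∀ j → j < m → ¬ P j))
least-witness {P = P} P? = <-rec _ improve
  where
  improve : ∀ k → (∀ {j} → j < k → P j → ∃[ m ] (P m × (∀ i → i < m → ¬ P i))) →
    P k → ∃[ m ] (P m × (∀ i → i < m → ¬ P i))
  improve k smaller Pk with anyUpTo? P? k
  ... | yes (j , j<k , Pj) = smaller j<k Pj
  ... | no none = k , Pk , λ j j<k Pj → none (j , j<k , Pj)

module Walks {n : ℕ} (X : Graph n) where

  adj-sym : ∀ {x y} → Adj X x y → Adj X y x
  adj-sym {x} {y} e = trans (Graph.sym X y x) e

  _++_ : ∀ {x y z i j} → Walk X x y i → Walk X y z j → Walk X x z (i + j)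
  here     ++ q = q
  step e p ++ q = step e (p ++ q)

  snoc : ∀ {x y z k} → Walk X x y k → Adj X y z → Walk X x z (suc k)
  snoc here       e = step e here
  snoc (step f p) e = step f (snoc p e)

  reverse : ∀ {x y k} → Walk X x y k → Walk X y x k
  reverse here       = here
  reverse (step e p) = snoc (reverse p) (adj-sym e)

  walk? : ∀ x y k → Dec (Walk X x y k)
  walk? x y zero with x ≟ᶠ y
  ... | yes refl = yes here
  ... | no x≢y   = no λ { here → x≢y refl }
  walk? x y (suc k) with any? (λ z → (adj X x z ≟ᵇ true) ×-dec walk? z y k)
  ... | yes (z , e , p) = yes (step e p)
  ... | no none         = no λ { (step e p) → none (_ , e , p) }

  shortest : ∀ {x y k} → Walk X x y k → ∃[ d ] IsDist X x y d
  shortest {x} {y} {k} p = least-witness (walk? x y) k p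

  dist-≤-walk : ∀ {x y d L} → IsDist X x y d → Walk X x y L → d ≤ L
  dist-≤-walk {d = d} {L} (_ , no-shorter) p with L <? d
  ... | yes L<d = ⊥-elim (no-shorter L L<d p)
  ... | no  L≮d = ≮⇒≥ L≮d

  record Entry {p} (P : Pred (Fin n) p) : Set p where
    field
      {from to} : Fin n
      outside   : ¬ P from
      inside    : P to
      edge      : Adj X from to

  entry : ∀ {p} {P : Pred (Fin n) p} → Decidable P →
    ∀ {x y k} → Walk X x y k → ¬ P x → P y → Entry P
  entry P? here                   ¬Px Py = ⊥-elim (¬Px Py)
  entry P? (step {y = m} e p) ¬Px Py with P? m
  ... | yes Pm = record { outside = ¬Px ; inside = Pm ; edge = e }
  ... | no ¬Pm = entry P? p ¬Pm Py

module Distances {n : ℕ} (G : Graph n) (connected : Connected G) where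
  open Walks G

  dist : Fin n → Fin n → ℕ
  dist x y = proj₁ (shortest (proj₂ (connected x y)))

  dist-isDist : ∀ x y → IsDist G x y (dist x y)
  dist-isDist x y = proj₂ (shortest (proj₂ (connected x y)))

  geodesic : ∀ x y → Walk G x y (dist x y)
  geodesic x y = proj₁ (dist-isDist x y)

  dist-min : ∀ {x y L} → Walk G x y L → dist x y ≤ L
  dist-min {x} {y} = dist-≤-walk (dist-isDist x y)

  triangle : ∀ x y z → dist x z ≤ dist x y + dist y z
  triangle x y z = dist-min (geodesic x y ++ geodesic y z)

SameEdge : ∀ {n} → Fin n → Fin n → Fin n → Fin n → Set
SameEdge u v x y = (x ≡ u × y ≡ v) ⊎ (x ≡ v × y ≡ u)

KeepsAllBut : ∀ {n} → Graph n → Graph n → Fin n → Fin n → Set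
KeepsAllBut G H u v = ∀ x y → Adj G x y → Adj H x y ⊎ SameEdge u v x y

KeepsAllBut-swap : ∀ {n} {G H : Graph n} {u v} →
  KeepsAllBut G H u v → KeepsAllBut G H v u
KeepsAllBut-swap keeps x y e with keeps x y e
... | inj₁ h                = inj₁ h
... | inj₂ (inj₁ same)      = inj₂ (inj₂ same)
... | inj₂ (inj₂ swapped)   = inj₂ (inj₁ swapped)

deleteEdge-keeps : ∀ {n} (G : Graph n) u v → KeepsAllBut G (deleteEdge G u v) u v
deleteEdge-keeps G u v x y e with adj G x y | e
... | true | _ with x ≟ᶠ u | y ≟ᶠ v | x ≟ᶠ v | y ≟ᶠ u
...   | yes x≡u | yes y≡v | _       | _       = inj₂ (inj₁ (x≡u , y≡v))
...   | _       | _       | yes x≡v | yes y≡u = inj₂ (inj₂ (x≡v , y≡u))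
...   | no _    | _       | no _    | _       = inj₁ refl
...   | no _    | _       | yes _   | no _    = inj₁ refl
...   | yes _   | no _    | no _    | _       = inj₁ refl
...   | yes _   | no _    | yes _   | no _    = inj₁ refl

module EdgeRemoval {n : ℕ} (G H : Graph n) (u v : Fin n)
  (keeps : KeepsAllBut G H u v) (connected : Connected G) where
  open Distances G connected
  open Walks H using (reverse; Entry; entry) renaming (_++_ to _++ᴴ_; dist-≤-walk to distᴴ-≤-walk)

  data Route (x z : Fin n) : ℕ → Set where
    in-H    : ∀ {k} → Walk H x z k → Route x z k
    via-uv  : ∀ {i j} → Walk G x u i → Walk G v z j → Route x z (suc (i + j))
    via-vu  : ∀ {i j} → Walk G x v i → Walk G u z j → Route x z (suc (i + j))

  route : ∀ {x z k} → Walk G x z k → Route x z k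
  route here = in-H here
  route (step {x} {y} e p) with keeps x y e
  ... | inj₂ (inj₁ (refl , refl)) = via-uv here p
  ... | inj₂ (inj₂ (refl , refl)) = via-vu here p
  ... | inj₁ h with route p
  ...   | in-H q     = in-H (step h q)
  ...   | via-uv q r = via-uv (step e q) r
  ...   | via-vu q r = via-vu (step e q) r

  short-walk-in-H : ∀ {w z k} → Walk G w z k →
    k ≤ dist w u + dist v z → k ≤ dist w v + dist u z → Walk H w z k
  short-walk-in-H p short-uv short-vu with route p
  ... | in-H q     = q
  ... | via-uv q r = ⊥-elim (<⇒≱ short-uv (+-mono-≤ (dist-min q) (dist-min r)))
  ... | via-vu q r = ⊥-elim (<⇒≱ short-vu (+-mono-≤ (dist-min q) (dist-min r)))

  -- Near endpoint: if u is at most as far from w as v, a shortest G-path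
  -- from w to u survives in H.
  near-endpoint : ∀ {w d} → dist w u ≤ dist w v → IsDist H w u d → d ≤ dist w u
  near-endpoint {w} a≤b isDist = distᴴ-≤-walk isDist
    (short-walk-in-H (geodesic w u) (m≤m+n _ _) (≤-trans a≤b (m≤m+n _ _)))

  Behind : Fin n → Fin n → Set
  Behind w z = dist w u + dist v z < dist w z

  Behind? : ∀ w → Decidable (Behind w)
  Behind? w z = suc (dist w u + dist v z) ≤? dist w z

  not-behind-self : ∀ w → ¬ Behind w w
  not-behind-self w behind = n≮0 (<-≤-trans behind (dist-min here))

  behind-closer-to-v : ∀ {w z} → Behind w z → dist v z < dist u z
  behind-closer-to-v {w} {z} behind =
    +-cancelˡ-< (dist w u) _ _ (<-≤-trans behind (triangle w u z))

  -- An H-walk from w to v crossing into the region behind the edge along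
  -- z'z gives dist_H(w,v) ≤ dist_G(w,z') + 1 + dist_G(v,z): both geodesics
  -- w → z' and v → z are short enough to avoid uv.
  detour : ∀ {w} → dist w u < dist w v → (e : Entry (Behind w)) →
    Walk H w v (dist w (Entry.from e) + suc (dist v (Entry.to e)))
  detour {w} a<b e = toward-z′ ++ᴴ step (Entry.edge e) (reverse from-v)
    where
    open Entry e renaming (from to z′; to to z)
    toward-z′ : Walk H w z′ (dist w z′)
    toward-z′ = short-walk-in-H (geodesic w z′) (≮⇒≥ outside)
      (≤-trans (triangle w u z′) (+-monoˡ-≤ (dist u z′) (<⇒≤ a<b)))
    from-v : Walk H v z (dist v z)
    from-v = short-walk-in-H (geodesic v z) (m≤n+m _ _)
      (≤-trans (<⇒≤ (behind-closer-to-v inside)) (m≤n+m _ _))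

  far-endpoint : ∀ D → (∀ x y → dist x y ≤ D) →
    ∀ {w d} → IsDist H w v d → dist w u + d ≤ D + D
  far-endpoint D bounded {w} {d} isDist with Behind? w v
  ... | no ¬behind = +-mono-≤ (bounded w u)
          (≤-trans (distᴴ-≤-walk isDist direct) (bounded w v))
    where
    direct : Walk H w v (dist w v)
    direct = short-walk-in-H (geodesic w v) (≮⇒≥ ¬behind) (m≤m+n _ _)
  ... | yes behind = begin
      dist w u + d                               ≤⟨ +-monoʳ-≤ (dist w u) (distᴴ-≤-walk isDist (detour a<b e)) ⟩
      dist w u + (dist w z′ + suc (dist v z))    ≡⟨ rearrange (dist w u) (dist w z′) (dist v z) ⟩
      dist w z′ + suc (dist w u + dist v z)      ≤⟨ +-mono-≤ (bounded w z′) (≤-trans (Entry.inside e) (bounded w z)) ⟩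
      D + D                                      ∎
    where
    open ≤-Reasoning
    a<b : dist w u < dist w v
    a<b = ≤-<-trans (m≤m+n (dist w u) (dist v v)) behind
    e : Entry (Behind w)
    e = entry (Behind? w) (proj₁ isDist) (not-behind-self w) behind
    z′ z : Fin n
    z′ = Entry.from e
    z  = Entry.to e
    rearrange : ∀ a x y → a + (x + suc y) ≡ x + suc (a + y)
    rearrange = solve-∀

-- The argument
-- only uses that H keeps every other edge of G.
lemma1 : (n : ℕ) (G : Graph n) (D : ℕ) → HasDiameter G D →
    (u v : Fin n) → Adj G u v → Connected (deleteEdge G u v) →
    (w : Fin n) (d₁ d₂ : ℕ) →
    IsDist (deleteEdge G u v) w u d₁ → IsDist (deleteEdge G u v) w v d₂ →
    d₁ + d₂ ≤ 2 * D
lemma1 n G D (connected , diameter , _) u v _ _ w d₁ d₂ dist₁ dist₂ =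
  ≤-trans bound (≤-reflexive (cong (D +_) (sym (+-identityʳ D))))
  where
  H : Graph n
  H = deleteEdge G u v
  open Distances G connected using (dist; dist-isDist)
  module UV = EdgeRemoval G H u v (deleteEdge-keeps G u v) connected
  module VU = EdgeRemoval G H v u (KeepsAllBut-swap {G = G} {H = H} (deleteEdge-keeps G u v)) connected
  bounded : ∀ x y → dist x y ≤ D
  bounded x y = diameter x y (dist x y) (dist-isDist x y)
  bound : d₁ + d₂ ≤ D + D
  bound with ≤-total (dist w u) (dist w v)
  ... | inj₁ a≤b = ≤-trans (+-monoˡ-≤ d₂ (UV.near-endpoint a≤b dist₁))
                           (UV.far-endpoint D bounded dist₂)
  ... | inj₂ b≤a = ≤-trans (≤-reflexive (+-comm d₁ d₂))
                   (≤-trans (+-monoˡ-≤ d₁ (VU.near-endpoint b≤a dist₂))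
                            (VU.far-endpoint D bounded dist₁))
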